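{- Let $O$ be a locally finite totally ordered set, let $S$ be an antichain of $(\mathscr I^\infty_O,\supseteq)$ and $M=\bigwedge\{\widetilde I: I\in S\}$ (meet in $\mathscr E_O$). Then $M$ is exactly the set of those finite intervals $J\in\mathscr I_O$ that are not contained in any interval of $S$ and are inclusion-minimal with this property.
   Context: Intervals of $O$ are convex subsets (including $\emptyset$); $\mathscr I_O$ = finite intervals, $\mathscr I^\infty_O$ = all intervals. $\mathscr E_O$ is the set of inclusion-antichains of elements of $\mathscr I_O$, ordered by $A\le B$ iff for every $I\in A$ there is $J\in B$ with $J\subseteq I$; it is a complete lattice. For $I\in\mathscr I^\infty_O$, $\widetilde I=\{\{x\}:x\in O\setminus I\}$. -}

module Defs where

open import Level using (0ℓ; Lift) renaming (suc to lsuc)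
open import Data.Product using (Σ; ∃; ∃-syntax; _×_; _,_)
open import Data.List using (List)
open import Data.List.Membership.Propositional using (_∈_)
open import Function.Bundles using (_⇔_)
open import Relation.Nullary using (¬_)
open import Relation.Unary using (Pred; _⊆_)
open import Relation.Binary using (Rel)
open import Relation.Binary.PropositionalEquality using (_≡_)

Subset : Set → Set₁
Subset O = Pred O 0ℓ

Family : Set → Set₂
Family O = Pred (Subset O) (lsuc 0ℓ)

_≐_ : {O : Set} → Subset O → Subset O → Set
I ≐ J = (I ⊆ J) × (J ⊆ I)

Finite : {O : Set} → Subset O → Set
Finite {O} P = ∃[ xs ] (∀ (x : O) → P x ⇔ x ∈ xs)

LocallyFinite : {O : Set} → Rel O 0ℓ → Set
LocallyFinite _≤_ = ∀ a b → Finite (λ x → (a ≤ x) × (x ≤ b))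

module Order {O : Set} (_≤_ : Rel O 0ℓ) where

  -- intervals = convex subsets (∅ included)
  IsInterval : Subset O → Set
  IsInterval I = ∀ {x y z} → I x → I z → x ≤ y → y ≤ z → I y

  IsFinInterval : Subset O → Set
  IsFinInterval I = IsInterval I × Finite I

  Antichain : Family O → Set₁
  Antichain A = ∀ I J → A I → A J → I ⊆ J → I ≐ J

  InE : Family O → Set₁
  InE A = (∀ I → A I → IsFinInterval I) × Antichain A

  _≤E_ : Family O → Family O → Set₁
  A ≤E B = ∀ I → A I → ∃[ J ] (B J × J ⊆ I)

  -- Ĩ = { {x} : x ∈ O ∖ I }
  tilde : Subset O → Family O
  tilde I K = Lift (lsuc 0ℓ) (∃[ x ] (¬ I x × (K ≐ (λ y → y ≡ x))))

  IsMeetOfTildes : Family O → Family O → Set₂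
  IsMeetOfTildes S M =
    InE M
    × (∀ I → S I → M ≤E tilde I)
    × (∀ A → InE A → (∀ I → S I → A ≤E tilde I) → A ≤E M)

  NotInS : Family O → Subset O → Set₁
  NotInS S J = ¬ (∃[ I ] (S I × J ⊆ I))

  MinimalUncovered : Family O → Family O
  MinimalUncovered S J =
    IsFinInterval J × NotInS S J
    × (∀ K → IsFinInterval K → K ⊆ J → NotInS S K → J ⊆ K)

  _≋_ : Family O → Family O → Set₁
  A ≋ B = (∀ I → A I → ∃[ J ] (B J × I ≐ J)) × (∀ J → B J → ∃[ I ] (A I × I ≐ J))

-- Classically, every uncovered finite interval contains a ⊆-minimal uncovered one, since a strictly
-- smaller subset of a finite set has a shorter enumeration. So the minimal uncovered intervals form
-- an element of 𝓔_O lying below every Ĩ, hence below M; conversely every element of M is uncovered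
-- and so lies above a minimal uncovered interval. Two antichains that are ≤ each other in 𝓔_O coincide.
module Submission where

open import Defs
open import Level using (Level; 0ℓ; _⊔_; lift) renaming (suc to lsuc)
open import Data.Product using (_×_; _,_; ∃; ∃-syntax; proj₁; proj₂)
open import Data.Nat using (suc; _<_)
open import Data.Nat.Properties using (<-≤-trans; ≤-pred; n<1+n)
open import Data.List using (List; length; filter)
open import Data.List.Properties using (filter-notAll)
open import Data.List.Membership.Propositional using (_∈_; lose)
open import Data.List.Membership.Propositional.Properties using (∈-filter⁺; ∈-filter⁻)
open import Function using (_∘_; id)
open import Function.Bundles using (_⇔_; mk⇔; Equivalence)
open import Relation.Binary using (Rel; IsTotalOrder)
open import Relation.Binary.PropositionalEquality using (_≡_; refl)
open import Relation.Nullary using (¬_; yes; no)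
open import Relation.Nullary.Decidable using (decidable-stable)
open import Relation.Unary using (_⊆_)
open import Axiom.ExcludedMiddle using (ExcludedMiddle)

Minimal : {ℓ : Level} {O : Set} → (Subset O → Set ℓ) → Subset O → Set (lsuc 0ℓ ⊔ ℓ)
Minimal Q J = Q J × (∀ K → Q K → K ⊆ J → J ⊆ K)

module _ {O : Set} (_≼_ : Rel O 0ℓ) where
  open Order _≼_

  ≤E-antisym⇒partner : {A B : Family O} → Antichain A → A ≤E B → B ≤E A →
                       ∀ I → A I → ∃[ J ] (B J × I ≐ J)
  ≤E-antisym⇒partner acA A≤B B≤A I AI with A≤B I AI
  ... | J , BJ , J⊆I with B≤A J BJ
  ...   | I' , AI' , I'⊆J with acA I' I AI' AI (J⊆I ∘ I'⊆J)
  ...     | _ , I⊆I' = J , BJ , I'⊆J ∘ I⊆I' , J⊆I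

  ≤E-antisym⇒≋ : {A B : Family O} → Antichain A → Antichain B → A ≤E B → B ≤E A → A ≋ B
  ≤E-antisym⇒≋ acA acB A≤B B≤A =
    ≤E-antisym⇒partner acA A≤B B≤A ,
    λ J BJ → let I , AI , J⊆I , I⊆J = ≤E-antisym⇒partner acB B≤A A≤B J BJ
             in I , AI , I⊆J , J⊆I

  below-tildes⇒uncovered : (S A : Family O) → (∀ I → S I → A ≤E tilde I) →
                           ∀ K → A K → NotInS S K
  below-tildes⇒uncovered S A A≤Ĩ K AK (I , SI , K⊆I) with A≤Ĩ I SI K AK
  ... | _ , lift (x , x∉I , J≐｛x｝) , J⊆K = x∉I (K⊆I (J⊆K (proj₂ J≐｛x｝ refl)))

  minimalUncovered-antichain : (S : Family O) → Antichain (MinimalUncovered S)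
  minimalUncovered-antichain S J J' (finJ , uncJ , _) (_ , _ , minJ') J⊆J' =
    J⊆J' , minJ' J finJ J⊆J' uncJ

module Classical (em : ∀ {ℓ} → ExcludedMiddle ℓ) {O : Set} where

  ⊈⇒∃∉ : {K L : Subset O} → ¬ K ⊆ L → ∃[ x ] (K x × ¬ L x)
  ⊈⇒∃∉ K⊈L = decidable-stable em λ ∄ →
    K⊈L λ {x} Kx → decidable-stable em λ ¬Lx → ∄ (x , Kx , ¬Lx)

  ⊂⇒shorter-enumeration : {K K' : Subset O} {xs : List O} → (∀ x → K x ⇔ x ∈ xs) →
                          K' ⊆ K → ¬ K ⊆ K' →
                          ∃[ ys ] ((∀ x → K' x ⇔ x ∈ ys) × length ys < length xs)
  ⊂⇒shorter-enumeration {K' = K'} {xs} K⇔xs K'⊆K K⊈K' with ⊈⇒∃∉ K⊈K'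
  ... | x , Kx , x∉K' =
    filter K'? xs , K'⇔ys , filter-notAll K'? xs (lose (Equivalence.to (K⇔xs x) Kx) x∉K')
    where
    K'? = λ y → em {P = K' y}

    K'⇔ys : ∀ y → K' y ⇔ y ∈ filter K'? xs
    K'⇔ys y = mk⇔ (λ K'y → ∈-filter⁺ K'? (Equivalence.to (K⇔xs y) (K'⊆K K'y)) K'y)
                  (proj₂ ∘ ∈-filter⁻ K'? {xs = xs})

  minimal-below : {ℓ : Level} (Q : Subset O → Set ℓ) {K : Subset O} → Finite K → Q K →
                  ∃[ J ] (Minimal Q J × J ⊆ K)
  minimal-below Q (xs , K⇔xs) QK = bounded (suc (length xs)) xs K⇔xs (n<1+n _) QK
    where
    bounded : ∀ n {K} (xs : List O) → (∀ x → K x ⇔ x ∈ xs) → length xs < n → Q K →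
              ∃[ J ] (Minimal Q J × J ⊆ K)
    bounded (suc n) {K} xs K⇔xs len<n QK with em {P = ∃[ K' ] (Q K' × K' ⊆ K × ¬ K ⊆ K')}
    ... | yes (K' , QK' , K'⊆K , K⊈K') with ⊂⇒shorter-enumeration K⇔xs K'⊆K K⊈K'
    ...   | ys , K'⇔ys , shorter with bounded n ys K'⇔ys (<-≤-trans shorter (≤-pred len<n)) QK'
    ...     | J , minJ , J⊆K' = J , minJ , K'⊆K ∘ J⊆K'
    bounded (suc n) {K} _ _ _ QK | no ∄smaller =
      K , (QK , λ K' QK' K'⊆K → decidable-stable em λ K⊈K' → ∄smaller (K' , QK' , K'⊆K , K⊈K')) , id

  module _ (_≼_ : Rel O 0ℓ) (S : Family O) where
    open Order _≼_

    minimalUncovered-below : ∀ K → IsFinInterval K → NotInS S K →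
                             ∃[ J ] (MinimalUncovered S J × J ⊆ K)
    minimalUncovered-below K finK uncK
      with minimal-below (λ J → IsFinInterval J × NotInS S J) (proj₂ finK) (finK , uncK)
    ... | J , ((finJ , uncJ) , minJ) , J⊆K =
      J , (finJ , uncJ , λ K' finK' K'⊆J uncK' → minJ K' (finK' , uncK') K'⊆J) , J⊆K

    minimalUncovered-≤E-tilde : ∀ I → S I → MinimalUncovered S ≤E tilde I
    minimalUncovered-≤E-tilde I SI J (_ , uncJ , _) with ⊈⇒∃∉ (λ J⊆I → uncJ (I , SI , J⊆I))
    ... | x , Jx , x∉I = (_≡ x) , lift (x , x∉I , id , id) , λ { refl → Jx }

proposition18 : (∀ {ℓ} → ExcludedMiddle ℓ) →
    (O : Set) (_≤_ : Rel O 0ℓ) → IsTotalOrder _≡_ _≤_ → LocallyFinite _≤_ →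
    (S : Family O) → (∀ I → S I → Order.IsInterval _≤_ I) → Order.Antichain _≤_ S →
    (M : Family O) → Order.IsMeetOfTildes _≤_ S M →
    Order._≋_ _≤_ M (Order.MinimalUncovered _≤_ S)
proposition18 em O _≤_ _ _ S _ _ M ((finM , acM) , M≤Ĩ , greatest) =
  ≤E-antisym⇒≋ _≤_ acM (minimalUncovered-antichain _≤_ S) M≤MU MU≤M
  where
  open Order _≤_
  open Classical em

  MU≤M : MinimalUncovered S ≤E M
  MU≤M = greatest (MinimalUncovered S)
                  ((λ _ → proj₁) , minimalUncovered-antichain _≤_ S)
                  (minimalUncovered-≤E-tilde _≤_ S)

  M≤MU : M ≤E MinimalUncovered S
  M≤MU I MI = minimalUncovered-below _≤_ S I (finM I MI)
                (below-tildes⇒uncovered _≤_ S M M≤Ĩ I MI)
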